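{- For every base $\mathcal{B}$ and formula $\varphi$: if $\Vdash^{\varnothing}_{\mathcal{B}}\varphi$, then $\Vdash^{\varnothing}_{\mathcal{B}}\,!\varphi$.
   Context: Fix a set $\mathbb{A}$ of propositional atoms. All multisets are finite; $\uplus$ denotes multiset union; an atomic multiset is a finite multiset of atoms. Formulae: $\varphi ::= p\in\mathbb{A}\mid\top\mid 0\mid 1\mid\varphi\multimap\varphi\mid\varphi\otimes\varphi\mid\varphi\mathbin{\&}\varphi\mid\varphi\oplus\varphi\mid\,!\varphi$. Bases. An atomic sequent is a pair $P\Rightarrow p$ ($P$ atomic multiset, $p$ atom); an atomic box is a finite multiset of atomic sequents; an atomic rule is a triple $\langle\mathbf{A},\mathbf{S},p\rangle$ with $\mathbf{A}$ a finite multiset of atomic boxes, $\mathbf{S}$ an atomic box, $p$ an atom. A base is a set of atomic rules; $\mathcal{C}\supseteq\mathcal{B}$ is set inclusion. An atom $p$ is persistent in $\mathcal{B}$ if $\mathcal{B}$ contains a rule $\langle\varnothing,\mathbf{S},p\rangle$ with $\mathbf{S}\neq\varnothing$. Derivability $P\vdash_{\mathcal{B}}p$ is the smallest relation closed under: (Ref) $\{p\}\vdash_{\mathcal{B}}p$; (App) if $\langle\mathbf{A},\mathbf{S},p\rangle\in\mathcal{B}$ with $\mathbf{A}=\{\mathbf{T}_1,\dots,\mathbf{T}_m\}$, and there are $n\ge m$, atomic multisets $C_1,\dots,C_n$ and a multiset $D=\{d_{m+1},\dots,d_n\}$ of atoms persistent in $\mathcal{B}$ with $C_i\uplus Q\vdash_{\mathcal{B}}q$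 for all $i\le m$ and $Q\Rightarrow q\in\mathbf{T}_i$, $C_j\vdash_{\mathcal{B}}d_j$ for all $m<j\le n$, and $D\uplus U\vdash_{\mathcal{B}}v$ for all $U\Rightarrow v\in\mathbf{S}$, then $C_1\uplus\dots\uplus C_n\vdash_{\mathcal{B}}p$. Support. For a base $\mathcal{B}$, atomic multiset $L$: (At) $\Vdash^L_{\mathcal{B}}p$ iff $L\vdash_{\mathcal{B}}p$; ($\multimap$) $\Vdash^L_{\mathcal{B}}\varphi\multimap\psi$ iff $\varphi\Vdash^L_{\mathcal{B}}\psi$; ($\otimes$) $\Vdash^L_{\mathcal{B}}\varphi\otimes\psi$ iff for all $\mathcal{C}\supseteq\mathcal{B}$, atomic multisets $K$, atoms $p$: if $\{\varphi,\psi\}\Vdash^K_{\mathcal{C}}p$ then $\Vdash^{L\uplus K}_{\mathcal{C}}p$; ($1$) $\Vdash^L_{\mathcal{B}}1$ iff for all $\mathcal{C}\supseteq\mathcal{B}$, $K$, $p$: if $\Vdash^K_{\mathcal{C}}p$ then $\Vdash^{L\uplus K}_{\mathcal{C}}p$; ($\mathbin{\&}$) $\Vdash^L_{\mathcal{B}}\varphi\mathbin{\&}\psi$ iff $\Vdash^L_{\mathcal{B}}\varphi$ and $\Vdash^L_{\mathcal{B}}\psi$; ($\oplus$) $\Vdash^L_{\mathcal{B}}\varphi\oplus\psi$ iff for all $\mathcal{C}\supseteq\mathcal{B}$, $K$, $p$: if $\varphi\Vdash^K_{\mathcal{C}}p$ and $\psi\Vdash^K_{\mathcal{C}}p$ then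 $\Vdash^{L\uplus K}_{\mathcal{C}}p$; ($0$) $\Vdash^L_{\mathcal{B}}0$ iff $\Vdash^{L\uplus K}_{\mathcal{B}}p$ for all atoms $p$ and atomic multisets $K$; ($\top$) $\Vdash^L_{\mathcal{B}}\top$ always; ($!$) $\Vdash^L_{\mathcal{B}}\,!\varphi$ iff for all $\mathcal{C}\supseteq\mathcal{B}$, $K$, $p$: if (for all $\mathcal{D}\supseteq\mathcal{C}$, $\Vdash^{\varnothing}_{\mathcal{D}}\varphi$ implies $\Vdash^K_{\mathcal{D}}p$) then $\Vdash^{L\uplus K}_{\mathcal{C}}p$. Multisets: $\Vdash^L_{\mathcal{B}}\varnothing$ iff $L=\varnothing$; $\Vdash^L_{\mathcal{B}}\{\varphi\}$ iff $\Vdash^L_{\mathcal{B}}\varphi$; $\Vdash^L_{\mathcal{B}}\Gamma\uplus\Delta$ iff $L=K\uplus M$ for some $K,M$ with $\Vdash^K_{\mathcal{B}}\Gamma$, $\Vdash^M_{\mathcal{B}}\Delta$. (Inf) For non-empty $\Gamma$, write $\Gamma=\,!\Delta\uplus\Theta$ with $!\Delta$ the elements whose top-level connective is $!$ and $\Theta$ the rest; $\Gamma\Vdash^L_{\mathcal{B}}\varphi$ iff for all $\mathcal{C}\supseteq\mathcal{B}$ and atomic $K$: if $\Vdash^{\varnothing}_{\mathcal{C}}\delta$ for every $\delta\in\Delta$ and $\Vdash^K_{\mathcal{C}}\Theta$, then $\Vdash^{L\uplus K}_{\mathcal{C}}\varphi$. For $\Gamma=\varnothing$, $\Gamma\Vdash^L_{\mathcal{B}}\varphi$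 means $\Vdash^L_{\mathcal{B}}\varphi$. -}

module Defs where

open import Data.List using (List; []; _∷_; _++_; concat; map)
open import Data.List.Membership.Propositional using (_∈_)
open import Data.List.Relation.Binary.Permutation.Propositional using (_↭_)
open import Data.List.Relation.Binary.Pointwise using (Pointwise)
open import Data.List.Relation.Unary.All using (All)
open import Data.Product using (Σ; _×_; _,_; proj₁; proj₂)
open import Relation.Binary.PropositionalEquality using (_≢_)
open import Level using (Lift; 0ℓ)
open import Data.Unit using () renaming (⊤ to ⊤₀)

Lift′ : Set → Set₁
Lift′ A = Lift (Level.suc 0ℓ) A

-- Base-extension semantics for intuitionistic linear logic, over a fixed
-- set of atoms `Atom`.  Finite multisets are represented by lists; multiset
-- union is `_++_`, multiset equality is permutation `_↭_`.
module BeS {Atom : Set} where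

  AMS : Set
  AMS = List Atom

  Sequent : Set
  Sequent = AMS × Atom

  Box : Set
  Box = List Sequent

  Rule : Set
  Rule = List Box × Box × Atom

  Base : Set₁
  Base = Rule → Set

  _⊇_ : Base → Base → Set
  C ⊇ B = ∀ r → B r → C r

  Persistent : Base → Atom → Set
  Persistent B p = Σ Box λ S → (S ≢ []) × B ([] , S , p)

  data Derivable (B : Base) : AMS → Atom → Set where
    ref : ∀ {L p} → L ↭ (p ∷ []) → Derivable B L p
    app : ∀ {L p} (As : List Box) (S : Box) → B (As , S , p) →
          (Cs : List AMS) →
          Pointwise (λ T C → ∀ {Q q} → (Q , q) ∈ T → Derivable B (C ++ Q) q) As Cs →
          (Es : List (AMS × Atom)) →
          All (λ e → Persistent B (proj₂ e) × Derivable B (proj₁ e) (proj₂ e)) Es →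
          (∀ {U v} → (U , v) ∈ S → Derivable B (map proj₂ Es ++ U) v) →
          L ↭ (concat Cs ++ concat (map proj₁ Es)) →
          Derivable B L p

  infixr 30 _⊸_
  infixr 35 _⊗_ _&_ _⊕_
  infix 40 !_

  data Formula : Set where
    atom : Atom → Formula
    ⊤′ 𝟘 𝟙 : Formula
    _⊸_ _⊗_ _&_ _⊕_ : Formula → Formula → Formula
    !_ : Formula → Formula

  mutual
    Supp : Base → AMS → Formula → Set₁
    Supp B L (atom p) = Lift′ (Derivable B L p)
    Supp B L ⊤′ = Lift′ ⊤₀
    Supp B L 𝟘 = ∀ p K → Lift′ (Derivable B (L ++ K) p)
    Supp B L 𝟙 = ∀ C → C ⊇ B → ∀ K p →
      Derivable C K p → Lift′ (Derivable C (L ++ K) p)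
    Supp B L (φ ⊸ ψ) = ∀ C → C ⊇ B → ∀ K →
      Hyp C K φ → Supp C (L ++ K) ψ
    Supp B L (φ ⊗ ψ) = ∀ C → C ⊇ B → ∀ K p →
      (∀ D → D ⊇ C → ∀ M → Σ AMS (λ M₁ → Σ AMS λ M₂ → (M ↭ (M₁ ++ M₂)) × Hyp D M₁ φ × Hyp D M₂ ψ) →
         Lift′ (Derivable D (K ++ M) p)) →
      Lift′ (Derivable C (L ++ K) p)
    Supp B L (φ & ψ) = Supp B L φ × Supp B L ψ
    Supp B L (φ ⊕ ψ) = ∀ C → C ⊇ B → ∀ K p →
      (∀ D → D ⊇ C → ∀ M → Hyp D M φ → Lift′ (Derivable D (K ++ M) p)) →
      (∀ D → D ⊇ C → ∀ M → Hyp D M ψ → Lift′ (Derivable D (K ++ M) p)) →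
      Lift′ (Derivable C (L ++ K) p)
    Supp B L (! φ) = ∀ C → C ⊇ B → ∀ K p →
      (∀ D → D ⊇ C → Supp D [] φ → Lift′ (Derivable D K p)) →
      Lift′ (Derivable C (L ++ K) p)

    -- contribution of one hypothesis χ of a context Γ in clause (Inf):
    -- if χ = !δ it must be supported with the empty multiset (δ ∈ Δ) and
    -- consumes no atoms; otherwise χ ∈ Θ consumes its share K.
    Hyp : Base → AMS → Formula → Set₁
    Hyp C K (atom p) = Supp C K (atom p)
    Hyp C K ⊤′ = Supp C K ⊤′
    Hyp C K 𝟘 = Supp C K 𝟘
    Hyp C K 𝟙 = Supp C K 𝟙
    Hyp C K (φ ⊸ ψ) = Supp C K (φ ⊸ ψ)
    Hyp C K (φ ⊗ ψ) = Supp C K (φ ⊗ ψ)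
    Hyp C K (φ & ψ) = Supp C K (φ & ψ)
    Hyp C K (φ ⊕ ψ) = Supp C K (φ ⊕ ψ)
    Hyp C K (! δ) = Lift′ (K ↭ []) × Supp C [] δ

{-# OPTIONS --safe #-}
module Submission where

-- Support is monotone under base extension.  So if φ is supported in ℬ, it
-- is supported in every 𝒞 ⊇ ℬ, and the hypothesis of the !-clause at 𝒞,
-- instantiated with 𝒟 = 𝒞, already gives the required derivation.

open import Data.List using (List; []; _∷_; _++_)
open import Data.List.Membership.Propositional using (_∈_)
open import Data.List.Relation.Binary.Pointwise using (Pointwise; []; _∷_)
open import Data.List.Relation.Unary.All using (All; []; _∷_)
open import Data.Product using (_,_; proj₁; proj₂; _×_)
open import Level using (lift; lower)

open import Defs
open Defs.BeS

module _ {Atom : Set} where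

  ⊇-refl : {B : Base {Atom}} → B ⊇ B
  ⊇-refl r Br = Br

  ⊇-trans : {B C D : Base {Atom}} → D ⊇ C → C ⊇ B → D ⊇ B
  ⊇-trans D⊇C C⊇B r Br = D⊇C r (C⊇B r Br)

  Persistent-mono : {B C : Base {Atom}} → C ⊇ B → ∀ {p} → Persistent B p → Persistent C p
  Persistent-mono C⊇B (S , S≢[] , rule) = S , S≢[] , C⊇B _ rule

  -- The premises of `app` are spelled out by hand (rather than via
  -- Pointwise.map / All.map) so that the termination checker sees the
  -- recursion on derivations.
  mutual
    Derivable-mono : {B C : Base {Atom}} → C ⊇ B → ∀ {L p} → Derivable B L p → Derivable C L p
    Derivable-mono C⊇B (ref L↭p) = ref L↭p
    Derivable-mono C⊇B (app As S rule Cs boxes Es persistents box perm) =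
      app As S (C⊇B _ rule) Cs (boxes-mono C⊇B boxes) Es (persistents-mono C⊇B persistents)
          (λ U⇒v∈S → Derivable-mono C⊇B (box U⇒v∈S)) perm

    boxes-mono : {B C : Base {Atom}} → C ⊇ B → ∀ {As Cs} →
      Pointwise (λ T Ctx → ∀ {Q q} → (Q , q) ∈ T → Derivable B (Ctx ++ Q) q) As Cs →
      Pointwise (λ T Ctx → ∀ {Q q} → (Q , q) ∈ T → Derivable C (Ctx ++ Q) q) As Cs
    boxes-mono C⊇B [] = []
    boxes-mono C⊇B (box ∷ boxes) =
      (λ Q⇒q∈T → Derivable-mono C⊇B (box Q⇒q∈T)) ∷ boxes-mono C⊇B boxes

    persistents-mono : {B C : Base {Atom}} → C ⊇ B → {Es : List (AMS {Atom} × Atom)} →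
      All (λ e → Persistent B (proj₂ e) × Derivable B (proj₁ e) (proj₂ e)) Es →
      All (λ e → Persistent C (proj₂ e) × Derivable C (proj₁ e) (proj₂ e)) Es
    persistents-mono C⊇B [] = []
    persistents-mono C⊇B ((pers , der) ∷ rest) =
      (Persistent-mono C⊇B pers , Derivable-mono C⊇B der) ∷ persistents-mono C⊇B rest

  Supp-mono : {B C : Base {Atom}} → C ⊇ B → ∀ {L} φ → Supp B L φ → Supp C L φ
  Supp-mono C⊇B (atom p) ⊩p = lift (Derivable-mono C⊇B (lower ⊩p))
  Supp-mono C⊇B ⊤′ ⊩⊤ = ⊩⊤
  Supp-mono C⊇B 𝟘 ⊩𝟘 p K = lift (Derivable-mono C⊇B (lower (⊩𝟘 p K)))
  Supp-mono C⊇B 𝟙 ⊩φ D D⊇C = ⊩φ D (⊇-trans D⊇C C⊇B)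
  Supp-mono C⊇B (φ ⊸ ψ) ⊩φ D D⊇C = ⊩φ D (⊇-trans D⊇C C⊇B)
  Supp-mono C⊇B (φ ⊗ ψ) ⊩φ D D⊇C = ⊩φ D (⊇-trans D⊇C C⊇B)
  Supp-mono C⊇B (φ & ψ) (⊩φ , ⊩ψ) = Supp-mono C⊇B φ ⊩φ , Supp-mono C⊇B ψ ⊩ψ
  Supp-mono C⊇B (φ ⊕ ψ) ⊩φ D D⊇C = ⊩φ D (⊇-trans D⊇C C⊇B)
  Supp-mono C⊇B (! φ) ⊩φ D D⊇C = ⊩φ D (⊇-trans D⊇C C⊇B)

mainTheorem14 : {Atom : Set} (B : Base {Atom}) (φ : Formula {Atom}) →
    Supp B [] φ → Supp B [] (! φ)
mainTheorem14 B φ ⊩φ C C⊇B K p φ⇒p = φ⇒p C ⊇-refl (Supp-mono C⊇B φ ⊩φ)
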